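{- Let $d\ge1$ and let $T$ be a $\psi$-tableau in which rows $d$ and $d+1$ have equal lengths. Then rows $d$ and $d+1$ of $T$ are identical (they carry the same labels in each column).
   Context: Young diagrams use English notation: rows indexed $1,2,\dots$ top to bottom, columns left to right, row lengths $\lambda_1\ge\lambda_2\ge\cdots$, $\lambda_j=0$ beyond the last row, $\lambda_0=+\infty$; $[m]=\{1,\dots,m\}$. For $d\ge1$, $h_Y(d)=\min\{h\ge1:\lambda_{d-h}\ge\lambda_d+h\}$ (height of the prime path of row $d$). If $B$ is the last box of row $x_B$, the $B$-strip is the set of last boxes of rows $x_B-h_Y(x_B)+1,\dots,x_B$; $B$ is a corner box if it is also lowest in its column. $Y'\gtrdot Y$ if $Y'$ is $Y$ with the $B$-strip of some corner box $B$ deleted. A tableau $T$ fills a Young diagram with positive integers, rows strictly increasing left to right, columns weakly increasing downward, label set exactly $[l]$, $l=l(T)$; $T^{(r)}$ consists of the boxes with labels $\le r$. A $\psi$-tableau is a tableau with $sh(T^{(r-1)})\gtrdot sh(T^{(r)})$ for all $r\in[l(T)]$ (it encodes a saturated chain from $\emptyset$ down to $sh(T)$). -}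

module Defs where

open import Data.Nat using (ℕ; zero; suc; _+_; _∸_; _≤_; _<_; _≤ᵇ_; _<ᵇ_)
open import Data.Bool using (Bool; true; false; if_then_else_; _∧_)
open import Data.Product using (Σ; ∃; ∃-syntax; _×_)
open import Data.Sum using (_⊎_)
open import Relation.Nullary using (¬_)
open import Relation.Binary.PropositionalEquality using (_≡_)

-- Conventions: a Young diagram is given by its row-length function
-- Y : ℕ → ℕ, where Y i = λ_i for rows i ≥ 1 (the value Y 0 is ignored;
-- the convention λ_0 = +∞ is built into `PrimeCond` below).
-- A filling is a function T : ℕ → ℕ → ℕ, T i j = label of the box in
-- row i ≥ 1, column j ≥ 1 (values outside the diagram are ignored).

InBox : (ℕ → ℕ) → ℕ → ℕ → Set
InBox Y i j = 1 ≤ i × 1 ≤ j × j ≤ Y i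

IsYoung : (ℕ → ℕ) → Set
IsYoung Y = (∀ i → 1 ≤ i → Y (suc i) ≤ Y i)
          × (∃[ N ] ∀ i → N ≤ i → Y i ≡ 0)

IsTableau : (ℕ → ℕ) → (ℕ → ℕ → ℕ) → ℕ → Set
IsTableau Y T l =
    IsYoung Y
  × (∀ i j → 1 ≤ i → 1 ≤ j → suc j ≤ Y i → T i j < T i (suc j))
  × (∀ i j → 1 ≤ i → 1 ≤ j → j ≤ Y (suc i) → T i j ≤ T (suc i) j)
  × (∀ i j → InBox Y i j → 1 ≤ T i j × T i j ≤ l)
  × (∀ r → 1 ≤ r → r ≤ l → ∃[ i ] ∃[ j ] (InBox Y i j × T i j ≡ r))

countLe : ℕ → (ℕ → ℕ) → ℕ → ℕ
countLe r f zero = 0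
countLe r f (suc n) = countLe r f n + (if f (suc n) ≤ᵇ r then 1 else 0)

-- row lengths of sh(T^{(r)}): boxes of row i with label ≤ r
subShape : (ℕ → ℕ) → (ℕ → ℕ → ℕ) → ℕ → (ℕ → ℕ)
subShape Y T r i = countLe r (T i) (Y i)

-- condition λ_{d-h} ≥ λ_d + h, with λ_0 = +∞ (i.e. automatic when h ≥ d)
PrimeCond : (ℕ → ℕ) → ℕ → ℕ → Set
PrimeCond Y d h = d ≤ h ⊎ Y d + h ≤ Y (d ∸ h)

PrimeHeight : (ℕ → ℕ) → ℕ → ℕ → Set
PrimeHeight Y d h = 1 ≤ h × PrimeCond Y d h
                  × (∀ h′ → 1 ≤ h′ → h′ < h → ¬ PrimeCond Y d h′)

IsCorner : (ℕ → ℕ) → ℕ → Set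
IsCorner Y x = 1 ≤ x × 1 ≤ Y x × Y (suc x) < Y x

delStrip : (ℕ → ℕ) → ℕ → ℕ → ℕ → ℕ
delStrip Y x h i = if (x <ᵇ i + h) ∧ (i ≤ᵇ x) then Y i ∸ 1 else Y i

Covers : (ℕ → ℕ) → (ℕ → ℕ) → Set
Covers Y′ Y = ∃[ x ] ∃[ h ] (IsCorner Y x × PrimeHeight Y x h
                × (∀ i → 1 ≤ i → Y′ i ≡ delStrip Y x h i))

IsPsiTableau : (ℕ → ℕ) → (ℕ → ℕ → ℕ) → ℕ → Set
IsPsiTableau Y T l = IsTableau Y T l
  × (∀ r → 1 ≤ r → r ≤ l → Covers (subShape Y T (r ∸ 1)) (subShape Y T r))

-- Deleting a strip never separates two rows of equal length: if exactly one of
-- rows d, d+1 lost its last box, then either d is the bottom row x of the strip,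
-- so its last box is not a corner, or d+1 is its top row x-h+1, and then h-1
-- already satisfies the prime-path condition, contradicting minimality of h.
-- Hence rows d and d+1 have equal lengths in every shape sh(T^(r)) of the chain.
-- Taking r = T d j, row d of T^(r) reaches column j, so row d+1 does too, i.e.
-- T (d+1) j ≤ T d j; the column condition gives the reverse inequality.
module Submission where

open import Defs
open import Data.Nat using (ℕ; suc; _≤_)
open import Relation.Binary.PropositionalEquality using (_≡_)

open import Data.Nat using (zero; _+_; _∸_; _<_; _≤ᵇ_; _<ᵇ_; z≤n; s≤s; z<s; _<?_; _≤?_)
open import Data.Nat.Properties
open import Data.Bool using (true; false; T; _∧_)
open import Data.Bool.Properties using (T-∧)
open import Data.Unit using (tt)
open import Data.Product using (_×_; _,_; proj₂)
open import Data.Sum using (inj₁; inj₂)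
open import Data.Empty using (⊥-elim)
open import Function using (_∘_)
open import Function.Bundles using (_⇔_; mk⇔; Equivalence)
open import Relation.Nullary using (¬_; Dec; yes; no; contradiction)
open import Relation.Nullary.Decidable using (_×-dec_)
open import Relation.Binary.PropositionalEquality
  using (_≢_; refl; sym; trans; cong; subst; module ≡-Reasoning)

InStrip : ℕ → ℕ → ℕ → Set
InStrip x h i = x < i + h × i ≤ x

inStrip? : ∀ x h i → Dec (InStrip x h i)
inStrip? x h i = (x <? i + h) ×-dec (i ≤? x)

T-strip⇔InStrip : ∀ {x h i} → T ((x <ᵇ i + h) ∧ (i ≤ᵇ x)) ⇔ InStrip x h i
T-strip⇔InStrip {x} {h} {i} = mk⇔
  (λ t → let (p , q) = Equivalence.to T-∧ t in <ᵇ⇒< x (i + h) p , ≤ᵇ⇒≤ i x q)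
  (λ (p , q) → Equivalence.from T-∧ (<⇒<ᵇ p , ≤⇒≤ᵇ q))

delStrip-in : ∀ Y {x h i} → InStrip x h i → delStrip Y x h i ≡ Y i ∸ 1
delStrip-in Y {x} {h} {i} s with (x <ᵇ i + h) ∧ (i ≤ᵇ x) in eq
... | true  = refl
... | false = ⊥-elim (subst T eq (Equivalence.from T-strip⇔InStrip s))

delStrip-out : ∀ Y {x h i} → ¬ InStrip x h i → delStrip Y x h i ≡ Y i
delStrip-out Y {x} {h} {i} ¬s with (x <ᵇ i + h) ∧ (i ≤ᵇ x) in eq
... | true  = ⊥-elim (¬s (Equivalence.to T-strip⇔InStrip (subst T (sym eq) tt)))
... | false = refl

¬PrimeHeight-above-equal-rows : ∀ {Y d h} → 1 ≤ d → Y d ≡ Y (suc d)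
                              → ¬ PrimeHeight Y (d + h) h
¬PrimeHeight-above-equal-rows {h = zero} _ _ (() , _)
¬PrimeHeight-above-equal-rows {d = d} {suc h′} 1≤d _ (_ , inj₁ d+h≤h , _) =
  n≮n (suc h′) (≤-trans (+-monoˡ-≤ (suc h′) 1≤d) d+h≤h)
¬PrimeHeight-above-equal-rows {Y} {d} {suc h′} _ Yd≡Yd+1 (_ , inj₂ cond , minimal) =
  refute h′ ≤-refl overshoot
  where
  x : ℕ
  x = d + suc h′

  x∸h′≡1+d : x ∸ h′ ≡ suc d
  x∸h′≡1+d = trans (cong (_∸ h′) (+-suc d h′)) (m+n∸n≡m (suc d) h′)

  overshoot : Y x + h′ < Y (x ∸ h′)
  overshoot = begin-strict
    Y x + h′            <⟨ +-monoʳ-< (Y x) (n<1+n h′) ⟩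
    Y x + suc h′        ≤⟨ cond ⟩
    Y (x ∸ suc h′)      ≡⟨ cong Y (m+n∸n≡m d (suc h′)) ⟩
    Y d                 ≡⟨ Yd≡Yd+1 ⟩
    Y (suc d)           ≡⟨ cong Y (sym x∸h′≡1+d) ⟩
    Y (x ∸ h′)          ∎
    where open ≤-Reasoning

  refute : ∀ k → k ≤ h′ → ¬ (Y x + k < Y (x ∸ k))
  refute zero    _   o = <⇒≱ o (m≤m+n (Y x) 0)
  refute (suc k) k<h′ o = minimal (suc k) (s≤s z≤n) (s≤s k<h′) (inj₂ (<⇒≤ o))

InStrip-equal-rows : ∀ {Y x h d} → 1 ≤ d → Y d ≡ Y (suc d)
                   → IsCorner Y x → PrimeHeight Y x h
                   → InStrip x h d ⇔ InStrip x h (suc d)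
InStrip-equal-rows {Y} {x} {h} {d} 1≤d Yd≡Yd+1 (_ , _ , corner) ph =
  mk⇔ lower raise
  where
  lower : InStrip x h d → InStrip x h (suc d)
  lower (x<d+h , d≤x) = m<n⇒m<1+n x<d+h , ≤∧≢⇒< d≤x d≢x
    where
    d≢x : d ≢ x
    d≢x refl = <-irrefl (sym Yd≡Yd+1) corner

  raise : InStrip x h (suc d) → InStrip x h d
  raise (x<1+d+h , d<x) = ≤∧≢⇒< (≤-pred x<1+d+h) x≢d+h , <⇒≤ d<x
    where
    x≢d+h : x ≢ d + h
    x≢d+h refl = ¬PrimeHeight-above-equal-rows {Y} 1≤d Yd≡Yd+1 ph

delStrip-cong : ∀ Y {x h i k} → (InStrip x h i ⇔ InStrip x h k) → Y i ≡ Y k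
              → delStrip Y x h i ≡ delStrip Y x h k
delStrip-cong Y {x} {h} {i} {k} i⇔k Yi≡Yk with inStrip? x h i
... | yes s = begin
  delStrip Y x h i  ≡⟨ delStrip-in Y s ⟩
  Y i ∸ 1           ≡⟨ cong (_∸ 1) Yi≡Yk ⟩
  Y k ∸ 1           ≡⟨ delStrip-in Y (Equivalence.to i⇔k s) ⟨
  delStrip Y x h k  ∎
  where open ≡-Reasoning
... | no ¬s = begin
  delStrip Y x h i  ≡⟨ delStrip-out Y ¬s ⟩
  Y i               ≡⟨ Yi≡Yk ⟩
  Y k               ≡⟨ delStrip-out Y (¬s ∘ Equivalence.from i⇔k) ⟨
  delStrip Y x h k  ∎
  where open ≡-Reasoning

Covers-preserves-equal-rows : ∀ {Y′ Y d} → 1 ≤ d → Covers Y′ Y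
                            → Y d ≡ Y (suc d) → Y′ d ≡ Y′ (suc d)
Covers-preserves-equal-rows {Y′} {Y} {d} 1≤d (x , h , corner , ph , Y′≡del) Yd≡Yd+1 = begin
  Y′ d                    ≡⟨ Y′≡del d 1≤d ⟩
  delStrip Y x h d        ≡⟨ delStrip-cong Y (InStrip-equal-rows 1≤d Yd≡Yd+1 corner ph) Yd≡Yd+1 ⟩
  delStrip Y x h (suc d)  ≡⟨ Y′≡del (suc d) (s≤s z≤n) ⟨
  Y′ (suc d)              ∎
  where open ≡-Reasoning

countLe-all : ∀ r f n → (∀ k → 1 ≤ k → k ≤ n → f k ≤ r) → countLe r f n ≡ n
countLe-all r f zero    _   = refl
countLe-all r f (suc n) f≤r with f (suc n) ≤ᵇ r in eq
... | true  = trans (cong (_+ 1) (countLe-all r f n (λ k 1≤k k≤n → f≤r k 1≤k (m≤n⇒m≤1+n k≤n))))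
                    (+-comm n 1)
... | false = contradiction (≤⇒≤ᵇ (f≤r (suc n) (s≤s z≤n) ≤-refl)) (subst T eq)

countLe-mono : ∀ r f {m n} → m ≤ n → countLe r f m ≤ countLe r f n
countLe-mono r f {n = zero}  z≤n = ≤-refl
countLe-mono r f {n = suc n} m≤n with m≤n⇒m<n∨m≡n m≤n
... | inj₂ refl        = ≤-refl
... | inj₁ (s≤s m≤n′) = ≤-trans (countLe-mono r f m≤n′) (m≤m+n _ _)

countLe-≤ : ∀ r f n → countLe r f n ≤ n
countLe-≤ r f zero = z≤n
countLe-≤ r f (suc n) with f (suc n) ≤ᵇ r
... | true  = ≤-trans (+-monoˡ-≤ 1 (countLe-≤ r f n)) (≤-reflexive (+-comm n 1))
... | false = ≤-trans (≤-reflexive (+-identityʳ _)) (m≤n⇒m≤1+n (countLe-≤ r f n))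

countLe-< : ∀ r f n {j} → 1 ≤ j → (∀ k → j ≤ k → k ≤ n → r < f k) → countLe r f n < j
countLe-< r f zero    1≤j _   = 1≤j
countLe-< r f (suc n) {j} 1≤j r<f with suc n <? j
... | yes n<j = <-≤-trans (s≤s (countLe-≤ r f (suc n))) n<j
... | no  n≮j with f (suc n) ≤ᵇ r in eq
...   | true  = contradiction (≤ᵇ⇒≤ _ _ (subst T (sym eq) tt)) (<⇒≱ (r<f (suc n) (≮⇒≥ n≮j) ≤-refl))
...   | false = <-≤-trans (s≤s (≤-reflexive (+-identityʳ _)))
                  (countLe-< r f n 1≤j (λ k j≤k k≤n → r<f k j≤k (m≤n⇒m≤1+n k≤n)))

StrictlyIncreasingOn : (ℕ → ℕ) → ℕ → Set
StrictlyIncreasingOn f n = ∀ j → 1 ≤ j → suc j ≤ n → f j < f (suc j)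

StrictlyIncreasingOn⇒monotone : ∀ {f n} → StrictlyIncreasingOn f n
                               → ∀ {k j} → 1 ≤ k → k ≤ j → j ≤ n → f k ≤ f j
StrictlyIncreasingOn⇒monotone inc {j = zero}  1≤k k≤0 _ = contradiction (≤-trans 1≤k k≤0) λ ()
StrictlyIncreasingOn⇒monotone inc {j = suc j} 1≤k k≤j+1 j+1≤n with m≤n⇒m<n∨m≡n k≤j+1
... | inj₂ refl        = ≤-refl
... | inj₁ (s≤s k≤j) =
  ≤-trans (StrictlyIncreasingOn⇒monotone inc 1≤k k≤j (≤-trans (n≤1+n j) j+1≤n))
          (<⇒≤ (inc j (≤-trans 1≤k k≤j) j+1≤n))

≤countLe⇔ : ∀ {f n} r → StrictlyIncreasingOn f n
          → ∀ {j} → 1 ≤ j → j ≤ n → (j ≤ countLe r f n ⇔ f j ≤ r)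
≤countLe⇔ {f} {n} r inc {j} 1≤j j≤n = mk⇔ to from
  where
  mono : ∀ {k j} → 1 ≤ k → k ≤ j → j ≤ n → f k ≤ f j
  mono = StrictlyIncreasingOn⇒monotone inc

  to : j ≤ countLe r f n → f j ≤ r
  to j≤count = ≮⇒≥ λ r<fj →
    <⇒≱ (countLe-< r f n 1≤j (λ k j≤k k≤n → <-≤-trans r<fj (mono 1≤j j≤k k≤n))) j≤count

  from : f j ≤ r → j ≤ countLe r f n
  from fj≤r = begin
    j                ≡⟨ countLe-all r f j (λ k 1≤k k≤j → ≤-trans (mono 1≤k k≤j j≤n) fj≤r) ⟨
    countLe r f j    ≤⟨ countLe-mono r f j≤n ⟩
    countLe r f n    ∎
    where open ≤-Reasoning

downward-induction : ∀ (P : ℕ → Set) {l} → P l → (∀ r → r < l → P (suc r) → P r)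
                   → ∀ {r} → r ≤ l → P r
downward-induction P {l} Pl step {r} r≤l = go (l ∸ r) (m+[n∸m]≡n r≤l)
  where
  go : ∀ k {r} → r + k ≡ l → P r
  go zero    {r} r+0≡l = subst P (trans (sym r+0≡l) (+-identityʳ r)) Pl
  go (suc k) {r} r+k≡l =
    step r (subst (r <_) r+k≡l (m<m+n r z<s)) (go k (trans (sym (+-suc r k)) r+k≡l))

subShape-complete : ∀ {Y T l i} → IsTableau Y T l → 1 ≤ i → subShape Y T l i ≡ Y i
subShape-complete {i = i} (_ , _ , _ , labels , _) 1≤i =
  countLe-all _ _ _ (λ k 1≤k k≤Yi → proj₂ (labels i k (1≤i , 1≤k , k≤Yi)))

≤subShape⇔ : ∀ {Y T l i j} r → IsTableau Y T l → 1 ≤ i → 1 ≤ j → j ≤ Y i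
           → (j ≤ subShape Y T r i ⇔ T i j ≤ r)
≤subShape⇔ {i = i} r (_ , rowInc , _) 1≤i = ≤countLe⇔ r (λ j 1≤j → rowInc i j 1≤i 1≤j)

subShape-equal-rows : ∀ {Y T l d} → IsPsiTableau Y T l → 1 ≤ d → Y d ≡ Y (suc d)
                    → ∀ {r} → r ≤ l → subShape Y T r d ≡ subShape Y T r (suc d)
subShape-equal-rows {Y} {T} {l} {d} (tab , covers) 1≤d Yd≡Yd+1 =
  downward-induction (λ r → subShape Y T r d ≡ subShape Y T r (suc d)) top
    (λ r r<l → Covers-preserves-equal-rows 1≤d (covers (suc r) (s≤s z≤n) r<l))
  where
  open ≡-Reasoning
  top : subShape Y T l d ≡ subShape Y T l (suc d)
  top = begin
    subShape Y T l d        ≡⟨ subShape-complete tab 1≤d ⟩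
    Y d                     ≡⟨ Yd≡Yd+1 ⟩
    Y (suc d)               ≡⟨ subShape-complete tab (s≤s z≤n) ⟨
    subShape Y T l (suc d)  ∎

lemma4p5 : (Y : ℕ → ℕ) (T : ℕ → ℕ → ℕ) (l d : ℕ)
    → IsPsiTableau Y T l → 1 ≤ d → Y d ≡ Y (suc d)
    → ∀ j → 1 ≤ j → j ≤ Y d → T d j ≡ T (suc d) j
lemma4p5 Y T l d ψ@(tab@(_ , _ , colInc , labels , _) , _) 1≤d Yd≡Yd+1 j 1≤j j≤Yd =
  ≤-antisym (colInc d j 1≤d 1≤j j≤Yd+1)
            (Equivalence.to (≤subShape⇔ (T d j) tab (s≤s z≤n) 1≤j j≤Yd+1) j≤row[d+1])
  where
  j≤Yd+1 : j ≤ Y (suc d)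
  j≤Yd+1 = subst (j ≤_) Yd≡Yd+1 j≤Yd

  j≤row[d] : j ≤ subShape Y T (T d j) d
  j≤row[d] = Equivalence.from (≤subShape⇔ (T d j) tab 1≤d 1≤j j≤Yd) ≤-refl

  j≤row[d+1] : j ≤ subShape Y T (T d j) (suc d)
  j≤row[d+1] = subst (j ≤_)
    (subShape-equal-rows ψ 1≤d Yd≡Yd+1 (proj₂ (labels d j (1≤d , 1≤j , j≤Yd)))) j≤row[d]
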